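{- Let $r\ge 2$ be a fixed integer and let $m=m(n)$ satisfy $n\ge m$ and $m/\log n\to\infty$ as $n\to\infty$. Then \[ \kappa_{r,2}(m,n) \ge \left(1-\frac{1}{r}\right)m - o(m). \]
   Context: $K_{m,n}$ denotes the complete bipartite graph with vertex classes $[m]$ and $[n]$. An $r$-edge-coloring is a map $c:E(K_{m,n})\to[r]$. A path is alternating if any two adjacent edges of it have different colors; the length of a path is its number of edges. Paths between two vertices are internally disjoint if they share no vertices other than their endpoints. $\kappa_{r,2}(m,n)$ is the maximum $t$ such that there is an $r$-edge-coloring of $K_{m,n}$ in which every pair of distinct vertices of the class $[n]$ is connected by $t$ internally disjoint alternating paths of length $2$. Asymptotic notation is as $n\to\infty$; $\log$ is the natural logarithm. -}

module Defs where

open import Data.Nat using (ℕ; _*_; _+_; _≤_; _^_)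
open import Data.Fin using (Fin)
open import Data.Product using (Σ; ∃; _×_)
open import Relation.Binary.PropositionalEquality using (_≡_)
open import Relation.Nullary using (¬_)
open import Function.Definitions using (Injective)

-- An r-edge-colouring of K_{m,n}: the edge between vertex w of the class [m]
-- and vertex u of the class [n] gets colour c w u.
Colouring : ℕ → ℕ → ℕ → Set
Colouring r m n = Fin m → Fin n → Fin r

-- In K_{m,n} a path of length 2 between u v ∈ [n] is u - w - v with w ∈ [m];
-- it is alternating iff its two edges have different colours.
AltPath2 : ∀ {r m n} → Colouring r m n → Fin n → Fin n → Fin m → Set
AltPath2 c u v w = ¬ (c w u ≡ c w v)

-- t internally disjoint alternating paths of length 2 between u and v:
-- t pairwise distinct middle vertices, each giving an alternating path.
DisjointAltPaths : ∀ {r m n} → Colouring r m n → Fin n → Fin n → ℕ → Set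
DisjointAltPaths {m = m} c u v t =
  Σ (Fin t → Fin m) λ w → Injective _≡_ _≡_ w × (∀ i → AltPath2 c u v (w i))

Witnesses : ∀ {r m n} → Colouring r m n → ℕ → Set
Witnesses {n = n} c t = ∀ (u v : Fin n) → ¬ (u ≡ v) → DisjointAltPaths c u v t

-- κ_{r,2}(m,n) ≥ t  (κ is the maximum such t, so this holds iff some
-- colouring witnesses t).
KappaAtLeast : ℕ → ℕ → ℕ → ℕ → Set
KappaAtLeast r m n t = Σ (Colouring r m n) λ c → Witnesses c t

-- m(n)/log n → ∞, expressed with log₂ (equivalent up to constant factors):
-- for every K, eventually K·log₂ n ≤ m(n), i.e. n^K ≤ 2^{m(n)}.
SuperLog : (ℕ → ℕ) → Set
SuperLog m = ∀ (K : ℕ) → ∃ λ N → ∀ n → N ≤ n → n ^ K ≤ 2 ^ m n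

module Submission where

-- Give each vertex of [n] the word in [r]^M (M = m n) of colours of its edges; two vertices
-- are joined by as many internally disjoint alternating 2-paths as their words have
-- disagreeing letters.  Words pairwise disagreeing in more than e places are picked greedily
-- (a derandomised Chernoff bound): weight a word v against a chosen word u by
-- (x+r)^agreements · x^disagreements.  Summed over all v this is (r(x+1))^M, so while
-- n(x+1)^M is below the weight (x+r)^a x^e of a word agreeing in exactly a = M - e places,
-- averaging yields a word lighter than that against every chosen word, hence far from each.
-- The numerical condition is checked blockwise, with D = 2kr, α = 2k + r, β = D - α and
-- x = 3^D: the binomial theorem and Bernoulli's inequality give (x+1)^D < (x+r)^α x^β;
-- raised to the power P = (x+1)^D this gap becomes a factor 2, and the b ≥ log₂ n blocks
-- of length DP that fit into M beat the factor n.  So e/M ≈ β/D = 1 - 1/r - 1/(2k).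

open import Defs
open import Data.Nat using (ℕ; zero; suc; _+_; _*_; _^_; _≤_; _<_; _∸_; z≤n; s≤s; _<?_; NonZero; >-nonZero)
open import Data.Nat.Properties hiding (_≟_)
open import Data.Fin using (Fin; zero; suc; _≟_)
import Data.Fin.Properties as Fin
open import Data.Nat.DivMod using (_/_; _%_; m≡m%n+[m/n]*n; m%n<n)
open import Data.Vec using (Vec; []; _∷_; lookup)
open import Data.Bool using (if_then_else_)
open import Data.Product using (Σ; ∃; _×_; _,_; proj₁; proj₂)
open import Function.Base using (_∘_)
open import Function.Definitions using (Injective)
open import Relation.Nullary using (¬_; yes; no; does; contradiction)
open import Relation.Binary.PropositionalEquality
open import Data.Nat.Tactic.RingSolver using (solve-∀)
import Algebra.Properties.CommutativeSemigroup as CommutativeSemigroupProperties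
open import Algebra.Properties.Semiring.Sum +-*-semiring
  using (sum; sum-cong-≗; ∑-distrib-+; *-distribˡ-sum; *-distribʳ-sum; sum-replicate-zero)

module +-CS = CommutativeSemigroupProperties +-commutativeSemigroup
module *-CS = CommutativeSemigroupProperties *-commutativeSemigroup

agreements : ∀ {r m} → Vec (Fin r) m → Vec (Fin r) m → ℕ
agreements []      []      = 0
agreements (a ∷ u) (b ∷ v) = if does (a ≟ b) then suc (agreements u v) else agreements u v

disagreements : ∀ {r m} → Vec (Fin r) m → Vec (Fin r) m → ℕ
disagreements []      []      = 0
disagreements (a ∷ u) (b ∷ v) = if does (a ≟ b) then disagreements u v else suc (disagreements u v)

agreements+disagreements : ∀ {r m} → (u v : Vec (Fin r) m) → agreements u v + disagreements u v ≡ m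
agreements+disagreements []      []      = refl
agreements+disagreements (a ∷ u) (b ∷ v) with a ≟ b
... | yes _ = cong suc (agreements+disagreements u v)
... | no  _ = trans (+-suc (agreements u v) (disagreements u v)) (cong suc (agreements+disagreements u v))

disagreements-sym : ∀ {r m} → (u v : Vec (Fin r) m) → disagreements u v ≡ disagreements v u
disagreements-sym []      []      = refl
disagreements-sym (a ∷ u) (b ∷ v) with a ≟ b | b ≟ a
... | yes _   | yes _   = disagreements-sym u v
... | no  _   | no  _   = cong suc (disagreements-sym u v)
... | yes a≡b | no  b≢a = contradiction (sym a≡b) b≢a
... | no  a≢b | yes b≡a = contradiction (sym b≡a) a≢b

DifferingPositions : ∀ {r m} → Vec (Fin r) m → Vec (Fin r) m → ℕ → Set
DifferingPositions {m = m} u v t =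
  Σ (Fin t → Fin m) λ w → Injective _≡_ _≡_ w × (∀ i → ¬ lookup u (w i) ≡ lookup v (w i))

differingPositions-zero : ∀ {r m} → (u v : Vec (Fin r) m) → DifferingPositions u v 0
differingPositions-zero _ _ = (λ ()) , (λ { {()} }) , (λ ())

differingPositions-skip : ∀ {r m} {a b} {u v : Vec (Fin r) m} {t} →
  DifferingPositions u v t → DifferingPositions (a ∷ u) (b ∷ v) t
differingPositions-skip (w , w-inj , w-differs) = suc ∘ w , w-inj ∘ Fin.suc-injective , w-differs

differingPositions-extend : ∀ {r m} {a b} {u v : Vec (Fin r) m} {t} → ¬ a ≡ b →
  DifferingPositions u v t → DifferingPositions (a ∷ u) (b ∷ v) (suc t)
differingPositions-extend {a = a} {b} {u} {v} {t} a≢b (w , w-inj , w-differs) = w′ , w′-inj , w′-differs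
  where
  w′ : Fin (suc t) → Fin (suc _)
  w′ zero    = zero
  w′ (suc i) = suc (w i)
  w′-inj : Injective _≡_ _≡_ w′
  w′-inj {zero}  {zero}  _  = refl
  w′-inj {suc i} {suc j} eq = cong suc (w-inj (Fin.suc-injective eq))
  w′-differs : ∀ i → ¬ lookup (a ∷ u) (w′ i) ≡ lookup (b ∷ v) (w′ i)
  w′-differs zero    = a≢b
  w′-differs (suc i) = w-differs i

differingPositions : ∀ {r m} → (u v : Vec (Fin r) m) (t : ℕ) → t ≤ disagreements u v → DifferingPositions u v t
differingPositions []      []      zero    _   = differingPositions-zero [] []
differingPositions (a ∷ u) (b ∷ v) t       t≤d with a ≟ b
... | yes _ = differingPositions-skip {u = u} {v} (differingPositions u v t t≤d)
differingPositions (a ∷ u) (b ∷ v) zero    _         | no _   = differingPositions-zero (a ∷ u) (b ∷ v)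
differingPositions (a ∷ u) (b ∷ v) (suc t) (s≤s t≤d) | no a≢b =
  differingPositions-extend {u = u} {v} a≢b (differingPositions u v t t≤d)

kappaAtLeast-of-code : ∀ {r m n} {t} (code : Vec (Vec (Fin r) m) n) →
  (∀ u v → ¬ u ≡ v → t ≤ disagreements (lookup code u) (lookup code v)) → KappaAtLeast r m n t
kappaAtLeast-of-code code far =
  (λ w u → lookup (lookup code u) w) , λ u v u≢v → differingPositions (lookup code u) (lookup code v) _ (far u v u≢v)

sumWords : ∀ {r} m → (Vec (Fin r) m → ℕ) → ℕ
sumWords zero    f = f []
sumWords (suc m) f = sum λ a → sumWords m (f ∘ (a ∷_))

module _ {r : ℕ} where

  sumWords-zero : ∀ m → sumWords {r} m (λ _ → 0) ≡ 0
  sumWords-zero zero    = refl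
  sumWords-zero (suc m) = trans (sum-cong-≗ {r} λ _ → sumWords-zero m) (sum-replicate-zero r)

  sumWords-+ : ∀ m (f g : Vec (Fin r) m → ℕ) →
    sumWords m (λ y → f y + g y) ≡ sumWords m f + sumWords m g
  sumWords-+ zero    f g = refl
  sumWords-+ (suc m) f g =
    trans (sum-cong-≗ {r} λ a → sumWords-+ m (f ∘ (a ∷_)) (g ∘ (a ∷_))) (∑-distrib-+ {r} _ _)

  sumWords-*ˡ : ∀ m k (f : Vec (Fin r) m → ℕ) → sumWords m (λ y → k * f y) ≡ k * sumWords m f
  sumWords-*ˡ zero    k f = refl
  sumWords-*ˡ (suc m) k f =
    trans (sum-cong-≗ {r} λ a → sumWords-*ˡ m k (f ∘ (a ∷_))) (sym (*-distribˡ-sum {r} k _))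

sum<⇒∃< : ∀ q (g : Fin q → ℕ) C → sum g < q * C → ∃ λ i → g i < C
sum<⇒∃< (suc q) g C ∑g<qC with g zero <? C
... | yes g₀<C = zero , g₀<C
... | no  g₀≮C
  with sum<⇒∃< q (g ∘ suc) C (+-cancelˡ-< C _ _ (≤-<-trans (+-monoˡ-≤ _ (≮⇒≥ g₀≮C)) ∑g<qC))
...   | i , gᵢ<C = suc i , gᵢ<C

sumWords<⇒∃< : ∀ {r} m (f : Vec (Fin r) m → ℕ) B → sumWords m f < r ^ m * B → ∃ λ y → f y < B
sumWords<⇒∃< zero    f B ∑f<B = [] , subst (f [] <_) (+-identityʳ B) ∑f<B
sumWords<⇒∃< {r} (suc m) f B ∑f<rᵐB
  with sum<⇒∃< r _ (r ^ m * B) (subst (sumWords (suc m) f <_) (*-assoc r (r ^ m) B) ∑f<rᵐB)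
... | a , ∑fₐ<B with sumWords<⇒∃< m (f ∘ (a ∷_)) B ∑fₐ<B
...   | y , fy<B = a ∷ y , fy<B

sum-const : ∀ q x → sum {q} (λ _ → x) ≡ q * x
sum-const zero    x = refl
sum-const (suc q) x = cong (x +_) (sum-const q x)

sum-bump : ∀ q (a : Fin q) x y → sum (λ b → if does (a ≟ b) then x + y else x) ≡ q * x + y
sum-bump (suc q) zero    x y = trans (cong (x + y +_) (sum-const q x)) (+-CS.xy∙z≈xz∙y x y (q * x))
sum-bump (suc q) (suc a) x y = trans (cong (x +_) (sum-bump q a x y)) (sym (+-assoc x (q * x) y))

weight : ∀ {r m} → ℕ → Vec (Fin r) m → Vec (Fin r) m → ℕ
weight         x []      []      = 1
weight {r = r} x (a ∷ u) (b ∷ v) = (if does (a ≟ b) then x + r else x) * weight x u v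

weight≡ : ∀ {r m} x (u v : Vec (Fin r) m) → weight x u v ≡ (x + r) ^ agreements u v * x ^ disagreements u v
weight≡         x []      []      = refl
weight≡ {r = r} x (a ∷ u) (b ∷ v) with a ≟ b
... | yes _ = trans (cong ((x + r) *_) (weight≡ x u v)) (sym (*-assoc (x + r) _ _))
... | no  _ = trans (cong (x *_) (weight≡ x u v)) (*-CS.x∙yz≈y∙xz x ((x + r) ^ agreements u v) (x ^ disagreements u v))

sumWords-weight : ∀ {r m} x (u : Vec (Fin r) m) → sumWords m (weight x u) ≡ r ^ m * (x + 1) ^ m
sumWords-weight         x []      = refl
sumWords-weight {r} {suc m} x (a ∷ u) = begin
  sum (λ b → sumWords m (λ v → factor b * weight x u v)) ≡⟨ sum-cong-≗ {r} (λ b → sumWords-*ˡ m (factor b) _) ⟩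
  sum (λ b → factor b * sumWords m (weight x u))         ≡⟨ sum-cong-≗ {r} (λ b → cong (factor b *_) IH) ⟩
  sum (λ b → factor b * W)                               ≡⟨ *-distribʳ-sum {r} W factor ⟨
  sum factor * W                                         ≡⟨ cong (_* W) (sum-bump r a x r) ⟩
  (r * x + r) * (r ^ m * (x + 1) ^ m)                    ≡⟨ lemma r x (r ^ m) ((x + 1) ^ m) ⟩
  r * r ^ m * ((x + 1) * (x + 1) ^ m)                    ∎
  where
  open ≡-Reasoning
  factor : Fin r → ℕ
  factor b = if does (a ≟ b) then x + r else x
  W : ℕ
  W = r ^ m * (x + 1) ^ m
  IH : sumWords m (weight x u) ≡ W
  IH = sumWords-weight x u
  lemma : ∀ r x R X → (r * x + r) * (R * X) ≡ r * R * ((x + 1) * X)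
  lemma = solve-∀

^-trade-≤ : ∀ {x y} → x ≤ y → ∀ a g e d → a ≤ g → a + e ≡ g + d → y ^ a * x ^ e ≤ y ^ g * x ^ d
^-trade-≤ {x} {y} x≤y zero g e d z≤n refl = begin
  1 * x ^ (g + d)   ≡⟨ trans (*-identityˡ _) (^-distribˡ-+-* x g d) ⟩
  x ^ g * x ^ d     ≤⟨ *-monoˡ-≤ (x ^ d) (^-monoˡ-≤ g x≤y) ⟩
  y ^ g * x ^ d     ∎
  where open ≤-Reasoning
^-trade-≤ {x} {y} x≤y (suc a) (suc g) e d (s≤s a≤g) eq = begin
  y * y ^ a * x ^ e   ≡⟨ *-assoc y _ _ ⟩
  y * (y ^ a * x ^ e) ≤⟨ *-monoʳ-≤ y (^-trade-≤ x≤y a g e d a≤g (suc-injective eq)) ⟩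
  y * (y ^ g * x ^ d) ≡⟨ *-assoc y _ _ ⟨
  y * y ^ g * x ^ d   ∎
  where open ≤-Reasoning

light⇒far : ∀ {r m} {a e} x (u v : Vec (Fin r) m) → a + e ≡ m →
  weight x u v < (x + r) ^ a * x ^ e → e < disagreements u v
light⇒far {r} {a = a} {e} x u v a+e≡m light with e <? disagreements u v
... | yes e<d = e<d
... | no  e≮d = contradiction (subst ((x + r) ^ a * x ^ e ≤_) (sym (weight≡ x u v)) heavy) (<⇒≱ light)
  where
  a+e≡g+d : a + e ≡ agreements u v + disagreements u v
  a+e≡g+d = trans a+e≡m (sym (agreements+disagreements u v))
  a≤g : a ≤ agreements u v
  a≤g = +-cancelʳ-≤ e a _ (subst (_≤ agreements u v + e) (sym a+e≡g+d) (+-monoʳ-≤ _ (≮⇒≥ e≮d)))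
  heavy : (x + r) ^ a * x ^ e ≤ (x + r) ^ agreements u v * x ^ disagreements u v
  heavy = ^-trade-≤ (m≤m+n x r) a _ e _ a≤g a+e≡g+d

module FarCode {r m : ℕ} .{{_ : NonZero r}} (x a e n : ℕ) (a+e≡m : a + e ≡ m)
  (chernoff : n * (x + 1) ^ m < (x + r) ^ a * x ^ e) where

  Word : Set
  Word = Vec (Fin r) m

  Far : ∀ {j} → Vec Word j → Set
  Far code = ∀ i i′ → ¬ i ≡ i′ → e < disagreements (lookup code i) (lookup code i′)

  load : ∀ {j} → Vec Word j → Word → ℕ
  load []         v = 0
  load (u ∷ code) v = weight x u v + load code v

  sumWords-load : ∀ {j} (code : Vec Word j) → sumWords m (load code) ≡ r ^ m * (j * (x + 1) ^ m)
  sumWords-load []         = trans (sumWords-zero m) (sym (*-zeroʳ (r ^ m)))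
  sumWords-load {suc j} (u ∷ code) = begin
    sumWords m (λ v → weight x u v + load code v)        ≡⟨ sumWords-+ m (weight x u) (load code) ⟩
    sumWords m (weight x u) + sumWords m (load code)     ≡⟨ cong₂ _+_ (sumWords-weight x u) (sumWords-load code) ⟩
    r ^ m * (x + 1) ^ m + r ^ m * (j * (x + 1) ^ m)      ≡⟨ *-distribˡ-+ (r ^ m) _ _ ⟨
    r ^ m * ((x + 1) ^ m + j * (x + 1) ^ m)              ∎
    where open ≡-Reasoning

  lightWord : ∀ {j} (code : Vec Word j) → j ≤ n → ∃ λ v → load code v < (x + r) ^ a * x ^ e
  lightWord {j} code j≤n = sumWords<⇒∃< m (load code) _ (begin-strict
    sumWords m (load code)               ≡⟨ sumWords-load code ⟩
    r ^ m * (j * (x + 1) ^ m)            <⟨ *-monoʳ-< (r ^ m) {{m^n≢0 r m}} (≤-<-trans (*-monoˡ-≤ _ j≤n) chernoff) ⟩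
    r ^ m * ((x + r) ^ a * x ^ e)        ∎)
    where open ≤-Reasoning

  light⇒far-from-all : ∀ {j} (code : Vec Word j) v → load code v < (x + r) ^ a * x ^ e →
    ∀ i → e < disagreements (lookup code i) v
  light⇒far-from-all (u ∷ code) v light zero    = light⇒far x u v a+e≡m (≤-<-trans (m≤m+n _ _) light)
  light⇒far-from-all (u ∷ code) v light (suc i) = light⇒far-from-all code v (≤-<-trans (m≤n+m _ _) light) i

  farCode : ∀ j → j ≤ n → Σ (Vec Word j) Far
  farCode zero    _     = [] , λ ()
  farCode (suc j) 1+j≤n with farCode j (≤-trans (n≤1+n j) 1+j≤n)
  ... | code , far with lightWord code (≤-trans (n≤1+n j) 1+j≤n)
  ...   | v , light = v ∷ code , far′
    where
    far-from-v : ∀ i → e < disagreements (lookup code i) v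
    far-from-v = light⇒far-from-all code v light
    far′ : Far (v ∷ code)
    far′ zero    zero     0≢0  = contradiction refl 0≢0
    far′ zero    (suc i′) _    = subst (e <_) (disagreements-sym (lookup code i′) v) (far-from-v i′)
    far′ (suc i) zero     _    = far-from-v i
    far′ (suc i) (suc i′) i≢i′ = far i i′ (i≢i′ ∘ cong suc)

kappaAtLeast-of-weights : ∀ {r m n} .{{_ : NonZero r}} x a e → a + e ≡ m →
  n * (x + 1) ^ m < (x + r) ^ a * x ^ e → KappaAtLeast r m n (suc e)
kappaAtLeast-of-weights {n = n} x a e a+e≡m chernoff with FarCode.farCode x a e n a+e≡m chernoff n ≤-refl
... | code , far = kappaAtLeast-of-code code far

*-distrib-^ : ∀ u v k → (u * v) ^ k ≡ u ^ k * v ^ k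
*-distrib-^ u v zero    = refl
*-distrib-^ u v (suc k) = trans (cong (u * v *_) (*-distrib-^ u v k)) (*-CS.interchange u v (u ^ k) (v ^ k))

^-cancelˡ-< : ∀ e {u v} → u ^ e < v ^ e → u < v
^-cancelˡ-< e {u} {v} uᵉ<vᵉ with u <? v
... | yes u<v = u<v
... | no  u≮v = contradiction (^-monoˡ-≤ e (≮⇒≥ u≮v)) (<⇒≱ uᵉ<vᵉ)

^-cancelʳ-< : ∀ y .{{_ : NonZero y}} {i j} → y ^ i < y ^ j → i < j
^-cancelʳ-< y {i} {j} yⁱ<yʲ with i <? j
... | yes i<j = i<j
... | no  i≮j = contradiction (^-monoʳ-≤ y (≮⇒≥ i≮j)) (<⇒≱ yⁱ<yʲ)

n≤3^n : ∀ n → n ≤ 3 ^ n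
n≤3^n zero    = z≤n
n≤3^n (suc n) = begin
  1 + n             ≤⟨ +-mono-≤ (m^n>0 3 n) (≤-trans (n≤3^n n) (m≤m+n _ _)) ⟩
  3 ^ n + (3 ^ n + 3 ^ n) ≡⟨ cong (3 ^ n +_) (cong (3 ^ n +_) (+-identityʳ (3 ^ n))) ⟨
  3 * 3 ^ n         ∎
  where open ≤-Reasoning

bernoulli : ∀ y z k → y ^ k * (y + k * z) ≤ y * (y + z) ^ k
bernoulli y z zero    = ≤-reflexive (lemma y z)
  where
  lemma : ∀ y z → 1 * (y + 0 * z) ≡ y * 1
  lemma = solve-∀
bernoulli y z (suc k) = begin
  y * y ^ k * (y + (1 + k) * z)                     ≤⟨ m≤m+n _ _ ⟩
  y * y ^ k * (y + (1 + k) * z) + y ^ k * (k * z * z) ≡⟨ lemma y z k (y ^ k) ⟩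
  (y + z) * (y ^ k * (y + k * z))                   ≤⟨ *-monoʳ-≤ (y + z) (bernoulli y z k) ⟩
  (y + z) * (y * (y + z) ^ k)                       ≡⟨ *-CS.x∙yz≈y∙xz (y + z) y _ ⟩
  y * ((y + z) * (y + z) ^ k)                       ∎
  where
  open ≤-Reasoning
  lemma : ∀ y z k Y → y * Y * (y + (1 + k) * z) + Y * (k * z * z) ≡ (y + z) * (Y * (y + k * z))
  lemma = solve-∀

binomial-upper-bound : ∀ x D .{{_ : NonZero x}} → x * x * (x + 1) ^ D ≤ x ^ D * (x * x + D * x + 3 ^ D)
binomial-upper-bound x zero    = ≤-trans (m≤m+n _ 1) (≤-reflexive (lemma x))
  where
  lemma : ∀ x → x * x * 1 + 1 ≡ 1 * (x * x + 0 * x + 1)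
  lemma = solve-∀
binomial-upper-bound x (suc D) = begin
  x * x * ((x + 1) * (x + 1) ^ D)                    ≡⟨ *-CS.x∙yz≈y∙xz (x * x) (x + 1) _ ⟩
  (x + 1) * (x * x * (x + 1) ^ D)                    ≤⟨ *-monoʳ-≤ (x + 1) (binomial-upper-bound x D) ⟩
  (x + 1) * (X * (x * x + D * x + T))                ≡⟨ lemma₁ x D X T ⟩
  x * X * (x * x + (1 + D) * x + T) + X * (D * x + T) ≤⟨ +-monoʳ-≤ _ (*-monoʳ-≤ X Dx+T≤2Tx) ⟩
  x * X * (x * x + (1 + D) * x + T) + X * (2 * T * x) ≡⟨ lemma₂ x D X T ⟩
  x * X * (x * x + (1 + D) * x + 3 * T)              ∎
  where
  open ≤-Reasoning
  X = x ^ D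
  T = 3 ^ D
  Dx+T≤2Tx : D * x + T ≤ 2 * T * x
  Dx+T≤2Tx = begin
    D * x + T         ≤⟨ +-mono-≤ (*-monoˡ-≤ x (n≤3^n D)) (m≤m*n T x) ⟩
    T * x + T * x     ≡⟨ cong (T * x +_) (+-identityʳ (T * x)) ⟨
    2 * (T * x)       ≡⟨ *-assoc 2 T x ⟨
    2 * T * x         ∎
  lemma₁ : ∀ x D X T → (x + 1) * (X * (x * x + D * x + T)) ≡ x * X * (x * x + (1 + D) * x + T) + X * (D * x + T)
  lemma₁ = solve-∀
  lemma₂ : ∀ x D X T → x * X * (x * x + (1 + D) * x + T) + X * (2 * T * x) ≡ x * X * (x * x + (1 + D) * x + 3 * T)
  lemma₂ = solve-∀

[x+1]^D<[x+r]^α*x^β : ∀ x r α β D .{{_ : NonZero x}} → α + β ≡ D → α * r ≡ D + r * r → 3 ^ D < r * r * x →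
  (x + 1) ^ D < (x + r) ^ α * x ^ β
[x+1]^D<[x+r]^α*x^β x r α β D α+β≡D αr≡D+r² 3ᴰ<r²x = *-cancelˡ-< (x * x) _ _ (begin-strict
  x * x * (x + 1) ^ D                     ≤⟨ binomial-upper-bound x D ⟩
  x ^ D * (x * x + D * x + 3 ^ D)         <⟨ *-monoʳ-< (x ^ D) {{m^n≢0 x D}} (+-monoʳ-< (x * x + D * x) 3ᴰ<r²x) ⟩
  x ^ D * (x * x + D * x + r * r * x)     ≡⟨ cong (x ^ D *_) (lemma₁ x D r) ⟩
  x ^ D * (x * (x + (D + r * r)))         ≡⟨ cong₂ (λ d c → x ^ d * (x * (x + c))) (sym α+β≡D) (sym αr≡D+r²) ⟩
  x ^ (α + β) * (x * (x + α * r))         ≡⟨ cong (_* (x * (x + α * r))) (^-distribˡ-+-* x α β) ⟩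
  x ^ α * x ^ β * (x * (x + α * r))       ≡⟨ lemma₂ (x ^ α) (x ^ β) x (x + α * r) ⟩
  x * x ^ β * (x ^ α * (x + α * r))       ≤⟨ *-monoʳ-≤ (x * x ^ β) (bernoulli x r α) ⟩
  x * x ^ β * (x * (x + r) ^ α)           ≡⟨ lemma₃ x (x ^ β) ((x + r) ^ α) ⟩
  x * x * ((x + r) ^ α * x ^ β)           ∎)
  where
  open ≤-Reasoning
  lemma₁ : ∀ x D r → x * x + D * x + r * r * x ≡ x * (x + (D + r * r))
  lemma₁ = solve-∀
  lemma₂ : ∀ A B x C → A * B * (x * C) ≡ x * B * (A * C)
  lemma₂ = solve-∀
  lemma₃ : ∀ x B W → x * B * (x * W) ≡ x * x * (W * B)
  lemma₃ = solve-∀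

2*y^y≤[y+1]^y : ∀ y .{{_ : NonZero y}} → 2 * y ^ y ≤ (y + 1) ^ y
2*y^y≤[y+1]^y y = *-cancelˡ-≤ y (begin
  y * (2 * y ^ y)         ≡⟨ lemma y (y ^ y) ⟩
  y ^ y * (y + y * 1)     ≤⟨ bernoulli y 1 y ⟩
  y * (y + 1) ^ y         ∎)
  where
  open ≤-Reasoning
  lemma : ∀ y Y → y * (2 * Y) ≡ Y * (y + y * 1)
  lemma = solve-∀

amplify : ∀ n b {u v} .{{_ : NonZero u}} → n < 2 ^ b → 2 * u ≤ v → n * u ^ b < v ^ b
amplify n b {u} {v} n<2ᵇ 2u≤v = begin-strict
  n * u ^ b          <⟨ *-monoˡ-< (u ^ b) {{m^n≢0 u b}} n<2ᵇ ⟩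
  2 ^ b * u ^ b      ≡⟨ *-distrib-^ 2 u b ⟨
  (2 * u) ^ b        ≤⟨ ^-monoˡ-≤ b 2u≤v ⟩
  v ^ b              ∎
  where open ≤-Reasoning

^-*-assoc₃ : ∀ y a p q → ((y ^ a) ^ p) ^ q ≡ y ^ (a * p * q)
^-*-assoc₃ y a p q = trans (cong (_^ q) (^-*-assoc y a p)) (^-*-assoc y (a * p) q)

[y^a*z^c]^p^q : ∀ y z a c p q → ((y ^ a * z ^ c) ^ p) ^ q ≡ y ^ (a * p * q) * z ^ (c * p * q)
[y^a*z^c]^p^q y z a c p q = begin
  ((y ^ a * z ^ c) ^ p) ^ q               ≡⟨ cong (_^ q) (*-distrib-^ (y ^ a) (z ^ c) p) ⟩
  ((y ^ a) ^ p * (z ^ c) ^ p) ^ q         ≡⟨ *-distrib-^ ((y ^ a) ^ p) ((z ^ c) ^ p) q ⟩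
  ((y ^ a) ^ p) ^ q * ((z ^ c) ^ p) ^ q   ≡⟨ cong₂ _*_ (^-*-assoc₃ y a p q) (^-*-assoc₃ z c p q) ⟩
  y ^ (a * p * q) * z ^ (c * p * q)       ∎
  where open ≡-Reasoning

m≡n*[m/n]+m%n : ∀ m n .{{_ : NonZero n}} → m ≡ n * (m / n) + m % n
m≡n*[m/n]+m%n m n = trans (m≡m%n+[m/n]*n m n) (trans (+-comm (m % n) _) (cong (_+ m % n) (*-comm (m / n) n)))

n<2^[M/E] : ∀ E .{{_ : NonZero E}} n M → 2 ≤ n → n ^ (2 * E) ≤ 2 ^ M → n < 2 ^ (M / E)
n<2^[M/E] E n M 2≤n nᴱ≤2ᴹ with n <? 2 ^ (M / E)
... | yes n<2ᵇ = n<2ᵇ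
... | no  n≮2ᵇ = contradiction n²<2ᵇ⁺¹ (≤⇒≯ (begin
  2 * 2 ^ (M / E) ≤⟨ *-mono-≤ 2≤n (≮⇒≥ n≮2ᵇ) ⟩
  n * n           ≡⟨ cong (n *_) (*-identityʳ n) ⟨
  n ^ 2           ∎))
  where
  open ≤-Reasoning
  M<[1+M/E]E : M < suc (M / E) * E
  M<[1+M/E]E = subst (_< suc (M / E) * E) (sym (m≡m%n+[m/n]*n M E)) (+-monoˡ-< (M / E * E) (m%n<n M E))
  n²<2ᵇ⁺¹ : n ^ 2 < 2 ^ suc (M / E)
  n²<2ᵇ⁺¹ = ^-cancelˡ-< E (begin-strict
    (n ^ 2) ^ E           ≡⟨ ^-*-assoc n 2 E ⟩
    n ^ (2 * E)           ≤⟨ nᴱ≤2ᴹ ⟩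
    2 ^ M                 <⟨ ^-monoʳ-< 2 (s≤s (s≤s z≤n)) M<[1+M/E]E ⟩
    2 ^ (suc (M / E) * E) ≡⟨ ^-*-assoc 2 (suc (M / E)) E ⟨
    (2 ^ suc (M / E)) ^ E ∎)

module Blocks (s j : ℕ) where

  r k D α β x P Q E : ℕ
  r = suc (suc s)
  k = suc j
  D = 2 * k * r
  α = 2 * k + r
  β = 2 * j * s + s + 2 * j
  x = 3 ^ D
  P = (x + 1) ^ D
  Q = (x + r) ^ α * x ^ β
  E = D * P

  instance
    x≢0 : NonZero x
    x≢0 = m^n≢0 3 D
    x+1≢0 : NonZero (x + 1)
    x+1≢0 = >-nonZero (m≤n+m 1 x)
    P≢0 : NonZero P
    P≢0 = m^n≢0 (x + 1) D
    E≢0 : NonZero E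
    E≢0 = m*n≢0 D P

  α+β≡D : α + β ≡ D
  α+β≡D = lemma j s
    where
    lemma : ∀ j s → 2 * suc j + suc (suc s) + (2 * j * s + s + 2 * j) ≡ 2 * suc j * suc (suc s)
    lemma = solve-∀

  αr≡D+r² : α * r ≡ D + r * r
  αr≡D+r² = lemma j s
    where
    lemma : ∀ j s → (2 * suc j + suc (suc s)) * suc (suc s) ≡ 2 * suc j * suc (suc s) + suc (suc s) * suc (suc s)
    lemma = solve-∀

  3ᴰ<r²x : 3 ^ D < r * r * x
  3ᴰ<r²x = subst (_< r * r * x) (*-identityˡ x) (*-monoˡ-< x {1} {r * r} (s≤s (s≤s z≤n)))

  2Pᴾ≤Qᴾ : 2 * P ^ P ≤ Q ^ P
  2Pᴾ≤Qᴾ = ≤-trans (2*y^y≤[y+1]^y P)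
    (^-monoˡ-≤ P (subst (_≤ Q) (+-comm 1 P) ([x+1]^D<[x+r]^α*x^β x r α β D α+β≡D αr≡D+r² 3ᴰ<r²x)))

  chernoff-blockwise : ∀ n b ρ → n < 2 ^ b →
    n * (x + 1) ^ (E * b + ρ) < (x + r) ^ (α * P * b + ρ) * x ^ (β * P * b)
  chernoff-blockwise n b ρ n<2ᵇ = begin-strict
    n * (x + 1) ^ (E * b + ρ)              ≡⟨ cong (n *_) (^-distribˡ-+-* (x + 1) (E * b) ρ) ⟩
    n * ((x + 1) ^ (E * b) * (x + 1) ^ ρ)  ≡⟨ cong (λ (y : ℕ) → n * (y * (x + 1) ^ ρ)) (^-*-assoc₃ (x + 1) D P b) ⟨
    n * ((P ^ P) ^ b * (x + 1) ^ ρ)        ≡⟨ *-assoc n ((P ^ P) ^ b) ((x + 1) ^ ρ) ⟨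
    n * (P ^ P) ^ b * (x + 1) ^ ρ          <⟨ *-monoˡ-< ((x + 1) ^ ρ) {{m^n≢0 (x + 1) ρ}} n[Pᴾ]ᵇ<[Qᴾ]ᵇ ⟩
    (Q ^ P) ^ b * (x + 1) ^ ρ              ≤⟨ *-monoʳ-≤ ((Q ^ P) ^ b) (^-monoˡ-≤ ρ (+-monoʳ-≤ x (s≤s z≤n))) ⟩
    (Q ^ P) ^ b * (x + r) ^ ρ              ≡⟨ cong (_* (x + r) ^ ρ) ([y^a*z^c]^p^q (x + r) x α β P b) ⟩
    A * B * (x + r) ^ ρ                    ≡⟨ *-CS.xy∙z≈xz∙y A B ((x + r) ^ ρ) ⟩
    A * (x + r) ^ ρ * B                    ≡⟨ cong (_* B) (^-distribˡ-+-* (x + r) (α * P * b) ρ) ⟨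
    (x + r) ^ (α * P * b + ρ) * B          ∎
    where
    open ≤-Reasoning
    A B : ℕ
    A = (x + r) ^ (α * P * b)
    B = x ^ (β * P * b)
    n[Pᴾ]ᵇ<[Qᴾ]ᵇ : n * (P ^ P) ^ b < (Q ^ P) ^ b
    n[Pᴾ]ᵇ<[Qᴾ]ᵇ = amplify n b {{m^n≢0 P P}} n<2ᵇ 2Pᴾ≤Qᴾ

  block-identity : k * (r ∸ 1) * D + k * r * r ≡ k * r * β + r * D
  block-identity = lemma j s
    where
    lemma : ∀ j s → suc j * suc s * (2 * suc j * suc (suc s)) + suc j * suc (suc s) * suc (suc s)
                  ≡ suc j * suc (suc s) * (2 * j * s + s + 2 * j) + suc (suc s) * (2 * suc j * suc (suc s))
    lemma = solve-∀

  target-inequality : ∀ b ρ → ρ < E → 2 * k ≤ b →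
    k * (r ∸ 1) * (E * b + ρ) ≤ k * r * suc (β * P * b) + r * (E * b + ρ)
  target-inequality b ρ ρ<E 2k≤b = begin
    k * (r ∸ 1) * (D * P * b + ρ)                     ≡⟨ *-distribˡ-+ (k * (r ∸ 1)) (D * P * b) ρ ⟩
    k * (r ∸ 1) * (D * P * b) + k * (r ∸ 1) * ρ       ≤⟨ +-monoʳ-≤ (k * (r ∸ 1) * (D * P * b)) remainder ⟩
    k * (r ∸ 1) * (D * P * b) + k * r * r * (P * b)   ≡⟨ lemma₁ (k * (r ∸ 1)) D (k * r * r) P b ⟩
    (k * (r ∸ 1) * D + k * r * r) * (P * b)           ≡⟨ cong (_* (P * b)) block-identity ⟩
    (k * r * β + r * D) * (P * b)                     ≡⟨ lemma₂ (k * r) β r D P b ⟩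
    k * r * (β * P * b) + r * (D * P * b)             ≤⟨ +-mono-≤ (*-monoʳ-≤ (k * r) (n≤1+n (β * P * b)))
                                                                  (*-monoʳ-≤ r (m≤m+n (D * P * b) ρ)) ⟩
    k * r * suc (β * P * b) + r * (D * P * b + ρ)     ∎
    where
    open ≤-Reasoning
    lemma₁ : ∀ A D B P b → A * (D * P * b) + B * (P * b) ≡ (A * D + B) * (P * b)
    lemma₁ = solve-∀
    lemma₂ : ∀ A β r D P b → (A * β + r * D) * (P * b) ≡ A * (β * P * b) + r * (D * P * b)
    lemma₂ = solve-∀
    lemma₃ : ∀ k r P → k * r * (2 * k * r * P) ≡ k * r * r * (P * (2 * k))
    lemma₃ = solve-∀
    remainder : k * (r ∸ 1) * ρ ≤ k * r * r * (P * b)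
    remainder = begin
      k * (r ∸ 1) * ρ          ≤⟨ *-monoˡ-≤ ρ (*-monoʳ-≤ k (n≤1+n (r ∸ 1))) ⟩
      k * r * ρ                ≤⟨ *-monoʳ-≤ (k * r) (<⇒≤ ρ<E) ⟩
      k * r * (2 * k * r * P)  ≡⟨ lemma₃ k r P ⟩
      k * r * r * (P * (2 * k)) ≤⟨ *-monoʳ-≤ (k * r * r) (*-monoʳ-≤ P 2k≤b) ⟩
      k * r * r * (P * b)      ∎

  kappaAtLeast-blockwise : ∀ n b ρ → ρ < E → n < 2 ^ b → 2 * k ≤ b →
    ∃ λ t → KappaAtLeast r (E * b + ρ) n t × (k * (r ∸ 1) * (E * b + ρ) ≤ k * r * t + r * (E * b + ρ))
  kappaAtLeast-blockwise n b ρ ρ<E n<2ᵇ 2k≤b =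
    suc (β * P * b) ,
    kappaAtLeast-of-weights x (α * P * b + ρ) (β * P * b) split (chernoff-blockwise n b ρ n<2ᵇ) ,
    target-inequality b ρ ρ<E 2k≤b
    where
    lemma : ∀ α β P b ρ → α * P * b + ρ + β * P * b ≡ (α + β) * P * b + ρ
    lemma = solve-∀
    split : α * P * b + ρ + β * P * b ≡ E * b + ρ
    split = trans (lemma α β P b ρ) (cong (λ d → d * P * b + ρ) α+β≡D)

lemma2p3 : (r : ℕ) → 2 ≤ r → (m : ℕ → ℕ) → (∀ n → m n ≤ n) → SuperLog m →
    ∀ (k : ℕ) → 1 ≤ k → ∃ λ N → ∀ n → N ≤ n →
      ∃ λ t → KappaAtLeast r (m n) n t × (k * (r ∸ 1) * m n ≤ k * r * t + r * m n)
lemma2p3 (suc (suc s)) (s≤s (s≤s _)) m _ superLog (suc j) (s≤s _) = N₀ + 2 ^ (2 * k) , large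
  where
  open Blocks s j
  N₀ : ℕ
  N₀ = proj₁ (superLog (2 * E))
  large : ∀ n → N₀ + 2 ^ (2 * k) ≤ n →
    ∃ λ t → KappaAtLeast r (m n) n t × (k * (r ∸ 1) * m n ≤ k * r * t + r * m n)
  large n N≤n = subst (λ M → ∃ λ t → KappaAtLeast r M n t × (k * (r ∸ 1) * M ≤ k * r * t + r * M))
    (sym (m≡n*[m/n]+m%n (m n) E)) (kappaAtLeast-blockwise n (m n / E) (m n % E) (m%n<n (m n) E) n<2ᵇ 2k≤b)
    where
    4ᵏ≤n : 2 ^ (2 * k) ≤ n
    4ᵏ≤n = ≤-trans (m≤n+m _ N₀) N≤n
    n<2ᵇ : n < 2 ^ (m n / E)
    n<2ᵇ = n<2^[M/E] E n (m n) (≤-trans (^-monoʳ-≤ 2 {1} {2 * k} (s≤s z≤n)) 4ᵏ≤n)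
      (proj₂ (superLog (2 * E)) n (≤-trans (m≤m+n N₀ _) N≤n))
    2k≤b : 2 * k ≤ m n / E
    2k≤b = <⇒≤ (^-cancelʳ-< 2 (≤-<-trans 4ᵏ≤n n<2ᵇ))
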